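{- Let $i,j,k$ be positive integers. If both $Q_i$ and $Q_j$ can be decomposed into paths of length $k$, then $Q_{i+j}$ can be decomposed into paths of length $k$.
   Context: The $m$-dimensional hypercube $Q_m$ is the graph with vertex set $\{0,1\}^m$ in which two vertices $x,y$ are adjacent iff $\|x-y\|_1 = 1$. A path of length $k$ is a sequence of distinct vertices $x_1,\dots,x_{k+1}$ with $x_i x_{i+1}$ an edge for all $1\le i\le k$. A decomposition of a graph into paths of length $k$ is a collection of paths of length $k$ in the graph whose edge sets partition the edge set of the graph. -}

module Defs where

open import Data.Nat using (ℕ; zero; suc; _+_)
open import Data.Bool using (Bool; true; false; _≟_)
open import Data.Vec using (Vec; []; _∷_)
open import Data.Fin using (Fin; inject₁) renaming (suc to fsuc)
open import Data.Product using (Σ; _×_; ∃)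
open import Data.Sum using (_⊎_)
open import Relation.Nullary using (yes; no)
open import Relation.Binary.PropositionalEquality using (_≡_)
open import Function.Definitions using (Injective)

Vertex : ℕ → Set
Vertex m = Vec Bool m

dist : ∀ {m} → Vertex m → Vertex m → ℕ
dist [] [] = 0
dist (a ∷ x) (b ∷ y) with a ≟ b
... | yes _ = dist x y
... | no _  = suc (dist x y)

Adj : ∀ {m} → Vertex m → Vertex m → Set
Adj x y = dist x y ≡ 1

record Path (m k : ℕ) : Set where
  field
    vert     : Fin (suc k) → Vertex m
    distinct : Injective _≡_ _≡_ vert
    adjacent : (p : Fin k) → Adj (vert (inject₁ p)) (vert (fsuc p))
open Path public

EdgeAt : ∀ {m k} → Path m k → Fin k → Vertex m → Vertex m → Set
EdgeAt P p u v =
  (vert P (inject₁ p) ≡ u × vert P (fsuc p) ≡ v)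
  ⊎ (vert P (inject₁ p) ≡ v × vert P (fsuc p) ≡ u)

-- a decomposition of Q_m into paths of length k: a finite family of paths
-- whose edge sets partition E(Q_m), i.e. every edge of Q_m is the edge at
-- exactly one (path index, position) pair
IsDecomposition : ∀ {m k n} → (Fin n → Path m k) → Set
IsDecomposition {m} {k} {n} P =
  (u v : Vertex m) → Adj u v →
    Σ (Fin n × Fin k) (λ { (t , p) → EdgeAt (P t) p u v
      × ((t' : Fin n) (p' : Fin k) → EdgeAt (P t') p' u v → (t ≡ t' × p ≡ p')) })
  where open Data.Product using (_,_)

Decomposable : ℕ → ℕ → Set
Decomposable m k = Σ ℕ (λ n → Σ (Fin n → Path m k) IsDecomposition)

-- A path decomposition of Q_i copied into every fibre Q_i × {y}, together with one of Q_j
-- copied into every fibre {x} × Q_j, decomposes Q_(i+j): an edge of Q_(i+j) changes exactly one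
-- coordinate, so it lies in exactly one fibre, and the copies of a path are again paths since
-- both fibre inclusions are injective and preserve adjacency.
module Submission where

open import Defs
open import Data.Nat using (ℕ; _+_; NonZero; zero; suc; _*_; _^_)
open import Data.Bool as Bool using (Bool)
open import Data.Vec using (Vec; []; _∷_; _++_; splitAt; uncons)
open import Data.Vec.Properties using (++-injectiveˡ; ++-injectiveʳ)
open import Data.Fin as Fin using (Fin; inject₁) renaming (suc to fsuc)
open import Data.Fin.Properties using (+↔⊎; *↔×; 2↔Bool)
open import Data.Product using (Σ; ∃; _×_; _,_)
open import Data.Product.Function.NonDependent.Propositional using (_×-↔_)
open import Data.Sum using (_⊎_; inj₁; inj₂)
open import Data.Sum.Function.Propositional using (_⊎-↔_)
open import Function using (_∘_)
open import Function.Bundles using (_↔_; Inverse; mk↔ₛ′)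
open import Function.Definitions using (Injective)
open import Function.Properties.Inverse using (↔-refl; ↔-trans)
open import Relation.Nullary using (yes; no; contradiction)
open import Relation.Binary.PropositionalEquality

private
  variable
    i j k m m′ n n₁ n₂ : ℕ

dist-++ : (x x′ : Vertex i) (y y′ : Vertex j) →
          dist (x ++ y) (x′ ++ y′) ≡ dist x x′ + dist y y′
dist-++ [] [] y y′ = refl
dist-++ (a ∷ x) (b ∷ x′) y y′ with a Bool.≟ b
... | yes _ = dist-++ x x′ y y′
... | no _  = cong suc (dist-++ x x′ y y′)

dist-self : (x : Vertex m) → dist x x ≡ 0
dist-self [] = refl
dist-self (a ∷ x) with a Bool.≟ a
... | yes _  = dist-self x
... | no a≢a = contradiction refl a≢a

dist≡0⇒≡ : (x y : Vertex m) → dist x y ≡ 0 → x ≡ y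
dist≡0⇒≡ [] [] _ = refl
dist≡0⇒≡ (a ∷ x) (b ∷ y) d with a Bool.≟ b
dist≡0⇒≡ (a ∷ x) (.a ∷ y) d | yes refl = cong (a ∷_) (dist≡0⇒≡ x y d)

Adj⇒≢ : {x y : Vertex m} → Adj x y → x ≢ y
Adj⇒≢ {x = x} adj refl with trans (sym (dist-self x)) adj
... | ()

Adj-++ʳ : (y : Vertex j) {u v : Vertex i} → Adj u v → Adj (u ++ y) (v ++ y)
Adj-++ʳ y {u} {v} adj = begin
  dist (u ++ y) (v ++ y)  ≡⟨ dist-++ u v y y ⟩
  dist u v + dist y y     ≡⟨ cong₂ _+_ adj (dist-self y) ⟩
  1                       ∎
  where open ≡-Reasoning

Adj-++ˡ : (x : Vertex i) {u v : Vertex j} → Adj u v → Adj (x ++ u) (x ++ v)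
Adj-++ˡ x {u} {v} adj = begin
  dist (x ++ u) (x ++ v)  ≡⟨ dist-++ x x u v ⟩
  dist x x + dist u v     ≡⟨ cong₂ _+_ (dist-self x) adj ⟩
  1                       ∎
  where open ≡-Reasoning

+≡1 : ∀ a {b} → a + b ≡ 1 → (a ≡ 1 × b ≡ 0) ⊎ (a ≡ 0 × b ≡ 1)
+≡1 zero             a+b≡1 = inj₂ (refl , a+b≡1)
+≡1 (suc zero) {zero} _    = inj₁ (refl , refl)

Adj-++-cases : (x x′ : Vertex i) (y y′ : Vertex j) → Adj (x ++ y) (x′ ++ y′) →
               (Adj x x′ × y ≡ y′) ⊎ (x ≡ x′ × Adj y y′)
Adj-++-cases x x′ y y′ adj with +≡1 (dist x x′) (trans (sym (dist-++ x x′ y y′)) adj)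
... | inj₁ (dx , dy) = inj₁ (dx , dist≡0⇒≡ y y′ dy)
... | inj₂ (dx , dy) = inj₂ (dist≡0⇒≡ x x′ dx , dy)

record Embedding (m m′ : ℕ) : Set where
  field
    embed           : Vertex m → Vertex m′
    embed-injective : Injective _≡_ _≡_ embed
    embed-Adj       : ∀ {u v} → Adj u v → Adj (embed u) (embed v)

module _ (e : Embedding m m′) where
  open Embedding e

  mapPath : Path m k → Path m′ k
  mapPath P = record
    { vert     = embed ∘ vert P
    ; distinct = distinct P ∘ embed-injective
    ; adjacent = embed-Adj ∘ adjacent P
    }

  EdgeAt-map : (P : Path m k) (p : Fin k) {u v : Vertex m} →
               EdgeAt P p u v → EdgeAt (mapPath P) p (embed u) (embed v)
  EdgeAt-map _ _ (inj₁ (eu , ev)) = inj₁ (cong embed eu , cong embed ev)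
  EdgeAt-map _ _ (inj₂ (ev , eu)) = inj₂ (cong embed ev , cong embed eu)

  EdgeAt-map⁻¹ : (P : Path m k) (p : Fin k) {u v : Vertex m} →
                 EdgeAt (mapPath P) p (embed u) (embed v) → EdgeAt P p u v
  EdgeAt-map⁻¹ _ _ (inj₁ (eu , ev)) = inj₁ (embed-injective eu , embed-injective ev)
  EdgeAt-map⁻¹ _ _ (inj₂ (ev , eu)) = inj₂ (embed-injective ev , embed-injective eu)

  EdgeAt-map-image : (P : Path m k) (p : Fin k) {u v : Vertex m′} →
                     EdgeAt (mapPath P) p u v → (∃ λ a → embed a ≡ u) × (∃ λ b → embed b ≡ v)
  EdgeAt-map-image _ _ (inj₁ (eu , ev)) = (_ , eu) , (_ , ev)
  EdgeAt-map-image _ _ (inj₂ (ev , eu)) = (_ , eu) , (_ , ev)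

append : Vertex j → Embedding i (i + j)
append y = record
  { embed           = _++ y
  ; embed-injective = ++-injectiveˡ _ _
  ; embed-Adj       = λ {u} {v} → Adj-++ʳ y {u} {v}
  }

prepend : Vertex i → Embedding j (i + j)
prepend x = record
  { embed           = x ++_
  ; embed-injective = ++-injectiveʳ x x
  ; embed-Adj       = λ {u} {v} → Adj-++ˡ x {u} {v}
  }

EdgeUniquelyAt : {I : Set} → (I → Path m k) → Vertex m → Vertex m → I × Fin k → Set
EdgeUniquelyAt {k = k} {I = I} P u v (t , p) =
  EdgeAt (P t) p u v × ((t′ : I) (p′ : Fin k) → EdgeAt (P t′) p′ u v → t ≡ t′ × p ≡ p′)

IsDecompositionOn : {I : Set} → (I → Path m k) → Set
IsDecompositionOn {m = m} {k = k} {I = I} P =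
  (u v : Vertex m) → Adj u v → Σ (I × Fin k) (EdgeUniquelyAt P u v)

reindex : {I : Set} (e : Fin n ↔ I) {P : I → Path m k} →
          IsDecompositionOn P → IsDecomposition (P ∘ Inverse.to e)
reindex e {P} D u v adj with D u v adj
... | (t , p) , edge , unique =
      (from t , p)
    , subst (λ s → EdgeAt (P s) p u v) (sym (strictlyInverseˡ t)) edge
    , λ t′ p′ edge′ → let t≡ , p≡ = unique (to t′) p′ edge′
                      in trans (cong from t≡) (strictlyInverseʳ t′) , p≡
  where open Inverse e

Decomposable-on : {I : Set} → Fin n ↔ I → (P : I → Path m k) → IsDecompositionOn P →
                  Decomposable m k
Decomposable-on {n = n} e P D = n , P ∘ Inverse.to e , reindex e {P} D

Fin↔Vertex : ∀ m → Fin (2 ^ m) ↔ Vertex m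
Fin↔Vertex zero    =
  mk↔ₛ′ (λ _ → []) (λ _ → Fin.zero) (λ { [] → refl }) (λ { Fin.zero → refl ; (fsuc ()) })
Fin↔Vertex (suc m) = ↔-trans *↔× (↔-trans (2↔Bool ×-↔ Fin↔Vertex m) uncons↔)
  where
  uncons↔ : (Bool × Vertex m) ↔ Vertex (suc m)
  uncons↔ = mk↔ₛ′ (λ (b , x) → b ∷ x) uncons (λ { (b ∷ x) → refl }) (λ _ → refl)

module ProductDecomposition (P₁ : Fin n₁ → Path i k) (D₁ : IsDecomposition P₁)
                            (P₂ : Fin n₂ → Path j k) (D₂ : IsDecomposition P₂) where

  Index : Set
  Index = (Vertex j × Fin n₁) ⊎ (Vertex i × Fin n₂)

  Fin↔Index : Fin (2 ^ j * n₁ + 2 ^ i * n₂) ↔ Index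
  Fin↔Index = ↔-trans +↔⊎ ( ↔-trans *↔× (Fin↔Vertex j ×-↔ ↔-refl)
                          ⊎-↔ ↔-trans *↔× (Fin↔Vertex i ×-↔ ↔-refl))

  paths : Index → Path (i + j) k
  paths (inj₁ (y , t)) = mapPath (append y) (P₁ t)
  paths (inj₂ (x , t)) = mapPath (prepend x) (P₂ t)

  horizontal : (x x′ : Vertex i) (y : Vertex j) → Adj x x′ →
               Σ (Index × Fin k) (EdgeUniquelyAt paths (x ++ y) (x′ ++ y))
  horizontal x x′ y adj with D₁ x x′ adj
  ... | (t , p) , edge , unique =
    (inj₁ (y , t) , p) , EdgeAt-map (append y) (P₁ t) p edge , unique′
    where
    unique′ : ∀ s p′ → EdgeAt (paths s) p′ (x ++ y) (x′ ++ y) → inj₁ (y , t) ≡ s × p ≡ p′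
    unique′ (inj₁ (y′ , t′)) p′ edge′ with EdgeAt-map-image (append y′) (P₁ t′) p′ edge′
    ... | (a , a++y′≡x++y) , _ with ++-injectiveʳ a x a++y′≡x++y
    ... | refl = let t≡t′ , p≡p′ = unique t′ p′ (EdgeAt-map⁻¹ (append y) (P₁ t′) p′ edge′)
                 in cong (λ s → inj₁ (y , s)) t≡t′ , p≡p′
    unique′ (inj₂ (x″ , t′)) p′ edge′ with EdgeAt-map-image (prepend x″) (P₂ t′) p′ edge′
    ... | (_ , x″++a≡x++y) , (_ , x″++b≡x′++y) =
      contradiction (trans (sym (++-injectiveˡ x″ x x″++a≡x++y)) (++-injectiveˡ x″ x′ x″++b≡x′++y))
                    (Adj⇒≢ adj)

  vertical : (x : Vertex i) (y y′ : Vertex j) → Adj y y′ →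
             Σ (Index × Fin k) (EdgeUniquelyAt paths (x ++ y) (x ++ y′))
  vertical x y y′ adj with D₂ y y′ adj
  ... | (t , p) , edge , unique =
    (inj₂ (x , t) , p) , EdgeAt-map (prepend x) (P₂ t) p edge , unique′
    where
    unique′ : ∀ s p′ → EdgeAt (paths s) p′ (x ++ y) (x ++ y′) → inj₂ (x , t) ≡ s × p ≡ p′
    unique′ (inj₂ (x′ , t′)) p′ edge′ with EdgeAt-map-image (prepend x′) (P₂ t′) p′ edge′
    ... | (a , x′++a≡x++y) , _ with ++-injectiveˡ x′ x x′++a≡x++y
    ... | refl = let t≡t′ , p≡p′ = unique t′ p′ (EdgeAt-map⁻¹ (prepend x) (P₂ t′) p′ edge′)
                 in cong (λ s → inj₂ (x , s)) t≡t′ , p≡p′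
    unique′ (inj₁ (y″ , t′)) p′ edge′ with EdgeAt-map-image (append y″) (P₁ t′) p′ edge′
    ... | (a , a++y″≡x++y) , (b , b++y″≡x++y′) =
      contradiction (trans (sym (++-injectiveʳ a x a++y″≡x++y)) (++-injectiveʳ b x b++y″≡x++y′))
                    (Adj⇒≢ adj)

  paths-isDecomposition : IsDecompositionOn paths
  paths-isDecomposition u v adj with splitAt i u | splitAt i v
  ... | x , y , refl | x′ , y′ , refl with Adj-++-cases x x′ y y′ adj
  ... | inj₁ (adjₓ , refl) = horizontal x x′ y adjₓ
  ... | inj₂ (refl , adjᵧ) = vertical x y y′ adjᵧ

lemma2p3 : (i j k : ℕ) → NonZero i → NonZero j → NonZero k →
    Decomposable i k → Decomposable j k → Decomposable (i + j) k
lemma2p3 i j k _ _ _ (_ , P₁ , D₁) (_ , P₂ , D₂) =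
  Decomposable-on Fin↔Index paths paths-isDecomposition
  where open ProductDecomposition P₁ D₁ P₂ D₂
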